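{- Let $G$ be a counterexample with the fewest number of vertices to the statement "every graph $G$ with $\mathrm{mad}(G)<\frac52$, $g(G)\geq 10$ and $\Delta(G)=4$ satisfies $\chi^2_l(G)\leq 6$". Then every special $(1,1,0)$-vertex of $G$ shares a common $2$-neighbor with a $4$-vertex.
   Context: Graphs are finite and simple. $\mathrm{mad}(G)$ is the maximum of $2|E(H)|/|V(H)|$ over subgraphs $H$ of $G$; $g(G)$ is the girth; $\Delta(G)$ the maximum degree. $\chi^2_l(G)$ is the smallest $k$ such that for every assignment of lists of size at least $k$ to the vertices there is a choice of colors from the lists with vertices at distance at most $2$ receiving different colors. A $d$-vertex ($d^+$-vertex) is a vertex of degree $d$ (at least $d$). A $k$-path is a path of length $k+1$ whose $k$ internal vertices are $2$-vertices and whose endvertices are $3^+$-vertices (so a $0$-path is an edge between two $3^+$-vertices). A $(k_1,\dots,k_d)$-vertex is a $d$-vertex incident to $d$ different paths, the $i$-th being a $k_i$-path. A $(1,1,1)$-vertex is small if the other endvertices of its three incident $1$-paths are all $3$-vertices. A special $(1,1,0)$-vertex is a $(1,1,0)$-vertex $u$ that has a $3$-neighbor and that is adjacent to a common $2$-vertex with a small $(1,1,1)$-vertex. Two vertices share a common $2$-neighbor if both are adjacent to the same $2$-vertex. -}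

module Defs where

open import Data.Nat using (ℕ; zero; suc; _+_; _*_; _≤_; _<_)
open import Data.Bool using (Bool; true; false)
open import Data.Fin using (Fin; zero; suc; inject₁; fromℕ)
open import Data.Fin.Subset using (Subset; ∣_∣; _∈_)
open import Data.Vec using (tabulate)
open import Data.List using (List; []; _∷_; length; lookup; map; allFin)
open import Data.Nat.ListAction using (sum)
open import Data.List.Relation.Unary.Unique.Propositional using (Unique)
import Data.List.Membership.Propositional as LM
open import Data.Product using (Σ; ∃; ∃-syntax; _×_; _,_)
open import Data.Sum using (_⊎_)
open import Relation.Binary.PropositionalEquality using (_≡_; _≢_)
open import Relation.Nullary using (¬_)

record Graph : Set where
  field
    n     : ℕ
    adj   : Fin n → Fin n → Bool
    sym   : ∀ u v → adj u v ≡ adj v u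
    irrefl : ∀ v → adj v v ≡ false

module _ (G : Graph) where
  open Graph G

  V : Set
  V = Fin n

  Adj : V → V → Set
  Adj u v = adj u v ≡ true

  deg : V → ℕ
  deg u = ∣ tabulate (adj u) ∣

  record Subgraph : Set where
    field
      S      : Subset n
      F      : V → V → Bool
      F-sym  : ∀ u v → F u v ≡ F v u
      F-sub  : ∀ u v → F u v ≡ true → Adj u v
      F-endˡ : ∀ u v → F u v ≡ true → u ∈ S

  -- sum of degrees in H = 2 |E(H)|
  degSum : Subgraph → ℕ
  degSum H = sum (map (λ u → ∣ tabulate (Subgraph.F H u) ∣) (allFin n))

  -- 2|E(H)|/|V(H)| < 5/2 for every subgraph with at least one vertex,
  -- i.e. 2 * (2|E(H)|) < 5 * |V(H)|
  MadLt5/2 : Set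
  MadLt5/2 = ∀ (H : Subgraph) → 0 < ∣ Subgraph.S H ∣ →
               2 * degSum H < 5 * ∣ Subgraph.S H ∣

  HasCycle : ℕ → Set
  HasCycle k = 3 ≤ k × (Σ (Fin (suc k) → V) λ c →
      c zero ≡ c (fromℕ k)
    × (∀ i j → c (inject₁ i) ≡ c (inject₁ j) → i ≡ j)
    × (∀ (i : Fin k) → Adj (c (inject₁ i)) (c (suc i))))

  GirthGe : ℕ → Set
  GirthGe g = ∀ k → k < g → ¬ HasCycle k

  MaxDegEq : ℕ → Set
  MaxDegEq d = (∀ v → deg v ≤ d) × (∃[ v ] deg v ≡ d)

  Dist≤2 : V → V → Set
  Dist≤2 u v = u ≢ v × (Adj u v ⊎ (∃[ w ] (Adj u w × Adj w v)))

  Choosable2 : ℕ → Set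
  Choosable2 k = ∀ (L : V → List ℕ) → (∀ v → Unique (L v)) → (∀ v → k ≤ length (L v)) →
    Σ (V → ℕ) λ c → ((∀ v → c v LM.∈ L v) × (∀ u v → Dist≤2 u v → c u ≢ c v))

  record KPath (k : ℕ) (u : V) : Set where
    field
      p        : Fin (suc (suc k)) → V
      start    : p zero ≡ u
      inj      : ∀ i j → p i ≡ p j → i ≡ j
      adjs     : ∀ (i : Fin (suc k)) → Adj (p (inject₁ i)) (p (suc i))
      internal : ∀ (i : Fin k) → deg (p (suc (inject₁ i))) ≡ 2
      start3   : 3 ≤ deg (p zero)
      end3     : 3 ≤ deg (p (fromℕ (suc k)))

    second : V
    second = p (suc zero)

    other-end : V
    other-end = p (fromℕ (suc k))

  -- (k₁,…,k_d)-vertex: a d-vertex incident to d different paths, the i-th a kᵢ-path.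
  -- (Paths starting at u are different iff their first edges differ.)
  record KVertex (ks : List ℕ) (u : V) : Set where
    field
      degree : deg u ≡ length ks
      paths  : (i : Fin (length ks)) → KPath (lookup ks i) u
      diff   : ∀ i j → KPath.second (paths i) ≡ KPath.second (paths j) → i ≡ j

  Small111 : V → Set
  Small111 u = Σ (KVertex (1 ∷ 1 ∷ 1 ∷ []) u) λ kv →
    ∀ i → deg (KPath.other-end (KVertex.paths kv i)) ≡ 3

  Common2Nbr : V → V → Set
  Common2Nbr u v = ∃[ w ] (deg w ≡ 2 × Adj u w × Adj v w)

  Special110 : V → Set
  Special110 u = KVertex (1 ∷ 1 ∷ 0 ∷ []) u
               × (∃[ x ] (Adj u x × deg x ≡ 3))
               × (∃[ v ] (Small111 v × Common2Nbr u v))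

Hyp : Graph → Set
Hyp G = MadLt5/2 G × GirthGe G 10 × MaxDegEq G 4

MinimalCounterexample : Graph → Set
MinimalCounterexample G =
  Hyp G × ¬ Choosable2 G 6 ×
  (∀ H → Graph.n H < Graph.n G → Hyp H → Choosable2 H 6)

-- Write the 1-paths of u as u w₁ v, with v the small (1,1,1)-vertex, and u w₂ y, and its 0-path as
-- u x, where x is the 3-neighbour. If y is a 4-vertex it shares w₂ with u. Otherwise y is a 3-vertex
-- and the configuration is reducible. G − w₁ keeps mad < 5/2, girth ≥ 10 and a 4-vertex (both
-- neighbours of w₁ are 3-vertices), so by minimality it has a 2-distance colouring from any 6-lists.
-- Keep it outside S = {u, w₁, w₂, v}: within distance two, u, w₂ and v see at most four vertices
-- outside S and w₁ at most three, so they keep 2, 3, 2 and 2 colours. By girth, w₂ and v are the only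
-- pair of S at distance more than two, so S must be coloured as K₄ minus an edge. If the lists of w₂
-- and v share a colour, use it on both; otherwise give w₁ a colour outside two options of u, which
-- misses the two options of w₂ or those of v, and colour the rest greedily.

{-# OPTIONS --safe #-}
module Submission where

open import Defs
import Data.Nat as ℕ
open import Data.Nat using (ℕ; zero; suc; _+_; _*_; _≤_; _<_; z≤n; s≤s; _≤?_)
open import Data.Nat.Properties
  using ( ≤-refl; ≤-reflexive; ≤-trans; ≤-antisym; ≤-pred; <-≤-trans; <⇒≱; ≰⇒>; ≤∧≢⇒<; suc-pred
        ; +-suc; m≤n+m; +-mono-≤; +-monoˡ-≤; +-monoʳ-≤; *-monoˡ-≤; +-0-commutativeMonoid
        ; module ≤-Reasoning )
open import Data.Fin using (Fin; zero; suc; punchIn; punchOut; inject₁; fromℕ)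
open import Data.Fin.Patterns using (0F; 1F; 2F; 3F)
import Data.Fin.Subset as Subset
open import Data.Fin.Subset using (∣_∣)
open import Data.Vec using (Vec; []; _∷_; tabulate; _∷ʳ_)
import Data.Vec as Vec
import Data.Vec.Properties as Vec
open import Data.Vec.Relation.Unary.Unique.Propositional using () renaming (Unique to UniqueVec)
import Data.Vec.Relation.Unary.Unique.Propositional.Properties as Vec
open import Data.Vec.Relation.Unary.Linked using (Linked; _∷_; [-])
open import Data.Vec.Relation.Unary.AllPairs using ([]; _∷_)
open import Data.Vec.Relation.Unary.All using ([]; _∷_)
open import Data.Vec.Functional using (insertAt)
open import Data.Vec.Functional.Properties using (insertAt-lookup; insertAt-punchIn)
import Data.Fin.Properties as Fin
import Data.List as List
import Data.List.Properties as List
open import Data.List using (List; []; _∷_; length; lookup; _++_; map; allFin)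
open import Data.Nat.ListAction using (sum)
open import Data.List.Properties using (length-++; map-tabulate; filter-notAll)
open import Data.List.Membership.Propositional using (_∈_; _∉_; find)
open import Data.List.Membership.Propositional.Properties
  using (∈-lookup; ∈-++⁺ˡ; ∈-++⁺ʳ; ∈-filter⁺; ∈-filter⁻; ∈-allFin; ∈-concatMap⁺; ∈-map⁺)
open import Data.List.Membership.DecPropositional as DecMembership using ()
open import Data.List.Relation.Unary.All as All using (All; all?; []; _∷_)
import Data.List.Relation.Unary.All.Properties as All
open import Data.List.Relation.Unary.All.Properties using (¬All⇒Any¬; ¬Any⇒All¬)
open import Data.List.Relation.Unary.Any as Any using (here; there; index; any?)
open import Data.List.Relation.Unary.Any.Properties using (lookup-index)
open import Data.List.Relation.Binary.Subset.Propositional using (_⊆_)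
open import Data.List.Relation.Unary.Unique.Propositional using (Unique; []; _∷_)
import Data.List.Relation.Unary.Unique.Propositional.Properties as Unique
open import Data.Product using (Σ; ∃-syntax; _×_; _,_; proj₁; proj₂)
import Data.Bool as Bool
open import Data.Bool using (Bool; true; false)
open import Data.Bool.Properties using (¬-not)
open import Data.Empty using (⊥-elim)
open import Data.Sum using (_⊎_; inj₁; inj₂)
open import Function using (_∘_; id)
open import Algebra.Properties.CommutativeMonoid.Sum +-0-commutativeMonoid
  using (sum-remove; sum-cong-≗; sum-replicate-zero) renaming (sum to ∑)
open import Relation.Binary.Definitions using (DecidableEquality)
open import Relation.Binary.PropositionalEquality
  using (_≡_; _≢_; ≢-sym; refl; sym; trans; cong; cong₂; cong-app; subst; subst₂; module ≡-Reasoning)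
open import Relation.Nullary using (¬_; ¬?; yes; no; contradiction)
open import Relation.Nullary.Decidable using (from-yes)

module _ {A : Set} where

  lookup-injective : {xs : List A} → Unique xs → ∀ i j → lookup xs i ≡ lookup xs j → i ≡ j
  lookup-injective (_ ∷ _)   zero    zero    _ = refl
  lookup-injective (x∉ ∷ _)  zero    (suc j) e = contradiction e (All.lookup x∉ (∈-lookup j))
  lookup-injective (x∉ ∷ _)  (suc i) zero    e = contradiction (sym e) (All.lookup x∉ (∈-lookup i))
  lookup-injective (_ ∷ xs!) (suc i) (suc j) e = cong suc (lookup-injective xs! i j e)

  unique-⊆⇒length≤ : {xs ys : List A} → Unique xs → xs ⊆ ys → length xs ≤ length ys
  unique-⊆⇒length≤ {xs} {ys} xs! xs⊆ys with length xs ≤? length ys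
  ... | yes xs≤ys = xs≤ys
  ... | no xs≰ys with Fin.pigeonhole (≰⇒> xs≰ys) position
    where position = λ i → index (xs⊆ys (∈-lookup i))
  ... | i , j , i<j , same = contradiction (lookup-injective xs! i j xsᵢ≡xsⱼ) (Fin.<⇒≢ i<j)
    where
    open ≡-Reasoning
    xsᵢ≡xsⱼ : lookup xs i ≡ lookup xs j
    xsᵢ≡xsⱼ = begin
      lookup xs i                                 ≡⟨ lookup-index (xs⊆ys (∈-lookup i)) ⟩
      lookup ys (index (xs⊆ys (∈-lookup i)))      ≡⟨ cong (lookup ys) same ⟩
      lookup ys (index (xs⊆ys (∈-lookup j)))      ≡⟨ sym (lookup-index (xs⊆ys (∈-lookup j))) ⟩
      lookup xs j                                 ∎

  ∈-swap : ∀ {x a b : A} {xs} → x ∈ a ∷ b ∷ xs → x ∈ b ∷ a ∷ xs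
  ∈-swap (here e)          = there (here e)
  ∈-swap (there (here e))  = here e
  ∈-swap (there (there p)) = there (there p)

module _ {A B : Set} (f : A → List B) where

  length-concatMap-≤ : ∀ {k xs} → All (λ a → length (f a) ≤ k) xs →
                       length (List.concatMap f xs) ≤ length xs * k
  length-concatMap-≤ []                           = z≤n
  length-concatMap-≤ {xs = x ∷ _} (fx≤k ∷ rest) =
    ≤-trans (≤-reflexive (length-++ (f x))) (+-mono-≤ fx≤k (length-concatMap-≤ rest))

  ∈-concatMap-∈ : ∀ {x y xs} → x ∈ xs → y ∈ f x → y ∈ List.concatMap f xs
  ∈-concatMap-∈ {y = y} x∈xs y∈fx =
    ∈-concatMap⁺ f (Any.map (λ x≡x′ → subst ((y ∈_) ∘ f) x≡x′ y∈fx) x∈xs)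

module _ {A : Set} (_≟_ : DecidableEquality A) where
  open DecMembership _≟_ using (_∈?_)

  ∃-∈-∉ : {xs ys : List A} → Unique xs → length ys < length xs →
          ∃[ x ] (x ∈ xs × x ∉ ys)
  ∃-∈-∉ {xs} {ys} xs! ys<xs with all? (_∈? ys) xs
  ... | yes xs⊆ys = contradiction (unique-⊆⇒length≤ xs! (All.lookup xs⊆ys)) (<⇒≱ ys<xs)
  ... | no xs⊈ys = find (¬All⇒Any¬ (_∈? ys) xs xs⊈ys)

open DecMembership ℕ._≟_ using (_∈?_)

-- Choosing colours for K₄ minus an edge

_∖_ : List ℕ → List ℕ → ℕ → Set
(L ∖ F) c = c ∈ L × c ∉ F

Avoidable : ℕ → (ℕ → Set) → Set
Avoidable k P = ∀ ys → length ys ≤ k → ∃[ c ] (P c × c ∉ ys)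

avoidable-∖ : ∀ {k L F} → Unique L → length F + suc k ≤ length L → Avoidable k (L ∖ F)
avoidable-∖ {k} {L} {F} L! F+k<L ys ys≤k with ∃-∈-∉ ℕ._≟_ L! F++ys<L
  where
  F++ys<L : length (F ++ ys) < length L
  F++ys<L = begin-strict
    length (F ++ ys)       ≡⟨ length-++ F ⟩
    length F + length ys   ≤⟨ +-monoʳ-≤ (length F) ys≤k ⟩
    length F + k           <⟨ ≤-reflexive (sym (+-suc (length F) k)) ⟩
    length F + suc k       ≤⟨ F+k<L ⟩
    length L               ∎
    where open ≤-Reasoning
... | c , c∈L , c∉F++ys = c , (c∈L , c∉F++ys ∘ ∈-++⁺ˡ) , c∉F++ys ∘ ∈-++⁺ʳ F

TwoDistinct : (ℕ → Set) → List ℕ → Set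
TwoDistinct P xs = Unique xs × length xs ≡ 2 × All P xs

choose-avoiding : ∀ {P xs} → TwoDistinct P xs → ∀ c → ∃[ d ] (P d × d ∈ xs × d ≢ c)
choose-avoiding (xs! , |xs|≡2 , Pxs) c with ∃-∈-∉ ℕ._≟_ {ys = c ∷ []} xs! (≤-reflexive (sym |xs|≡2))
... | d , d∈xs , d∉[c] = d , All.lookup Pxs d∈xs , d∈xs , d∉[c] ∘ here

two-distinct : ∀ {P} → Avoidable 1 P → ∃[ xs ] TwoDistinct P xs
two-distinct av with av [] z≤n
... | a , Pa , _ with av (a ∷ []) ≤-refl
...   | b , Pb , b∉[a] = a ∷ b ∷ [] , ((b∉[a] ∘ here ∘ sym) ∷ []) ∷ [] ∷ [] , refl , Pa ∷ Pb ∷ []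

record DiamondColouring (H₁ H₂ T₁ T₂ : ℕ → Set) : Set where
  constructor diamond
  field
    h₁ h₂ t₁ t₂ : ℕ
    h₁∈ : H₁ h₁
    h₂∈ : H₂ h₂
    t₁∈ : T₁ t₁
    t₂∈ : T₂ t₂
    h₁≢h₂ : h₁ ≢ h₂
    h₁≢t₁ : h₁ ≢ t₁
    h₁≢t₂ : h₁ ≢ t₂
    h₂≢t₁ : h₂ ≢ t₁
    h₂≢t₂ : h₂ ≢ t₂

swap-tips : ∀ {H₁ H₂ T₁ T₂} → DiamondColouring H₁ H₂ T₁ T₂ → DiamondColouring H₁ H₂ T₂ T₁
swap-tips (diamond h₁ h₂ t₁ t₂ h₁∈ h₂∈ t₁∈ t₂∈ h₁≢h₂ h₁≢t₁ h₁≢t₂ h₂≢t₁ h₂≢t₂) =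
  diamond h₁ h₂ t₂ t₁ h₁∈ h₂∈ t₂∈ t₁∈ h₁≢h₂ h₁≢t₂ h₁≢t₁ h₂≢t₂ h₂≢t₁

diamond-greedy : ∀ {H₁ H₂ T₁ T₂ as gs ds β} → TwoDistinct H₁ as → TwoDistinct T₁ gs → TwoDistinct T₂ ds →
                 H₂ β → β ∉ as → β ∉ ds → DiamondColouring H₁ H₂ T₁ T₂
diamond-greedy {as = as} {ds = ds} {β = β} A G D H₂β β∉as β∉ds with choose-avoiding G β
... | γ , γ∈ , _ , γ≢β with choose-avoiding A γ
...   | h₁ , h₁∈ , h₁∈as , h₁≢γ with choose-avoiding D h₁
...     | δ , δ∈ , δ∈ds , δ≢h₁ =
  diamond h₁ β γ δ h₁∈ H₂β γ∈ δ∈ (λ h₁≡β → β∉as (subst (_∈ as) h₁≡β h₁∈as)) h₁≢γ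
    (δ≢h₁ ∘ sym) (γ≢β ∘ sym) (λ β≡δ → β∉ds (subst (_∈ ds) (sym β≡δ) δ∈ds))

module _ {H₁ H₂ T₁ T₂ : ℕ → Set} where

  diamond-shared-tip : ∀ {c} → Avoidable 1 H₁ → Avoidable 2 H₂ → T₁ c → T₂ c →
                       DiamondColouring H₁ H₂ T₁ T₂
  diamond-shared-tip {c} avH₁ avH₂ T₁c T₂c with avH₁ (c ∷ []) ≤-refl
  ... | h₁ , h₁∈ , h₁∉ with avH₂ (c ∷ h₁ ∷ []) ≤-refl
  ...   | h₂ , h₂∈ , h₂∉ =
    diamond h₁ h₂ c c h₁∈ h₂∈ T₁c T₂c
      (h₂∉ ∘ there ∘ here ∘ sym) (h₁∉ ∘ here) (h₁∉ ∘ here) (h₂∉ ∘ here) (h₂∉ ∘ here)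

  diamond-choosable : Avoidable 1 H₁ → Avoidable 2 H₂ → Avoidable 1 T₁ → Avoidable 1 T₂ →
                      DiamondColouring H₁ H₂ T₁ T₂
  diamond-choosable avH₁ avH₂ avT₁ avT₂
    with two-distinct avH₁ | two-distinct avT₁ | two-distinct avT₂
  ... | as , A | gs , G@(_ , _ , T₁gs) | ds , D@(_ , _ , T₂ds) with any? (_∈? ds) gs
  ...   | yes shared = let c , c∈gs , c∈ds = find shared in
          diamond-shared-tip avH₁ avH₂ (All.lookup T₁gs c∈gs) (All.lookup T₂ds c∈ds)
  ...   | no disjoint with avH₂ as (≤-reflexive (proj₁ (proj₂ A)))
  ...     | β , H₂β , β∉as with β ∈? ds
  ...       | no β∉ds = diamond-greedy A G D H₂β β∉as β∉ds
  ...       | yes β∈ds = swap-tips (diamond-greedy A D G H₂β β∉as β∉gs)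
    where
    β∉gs : β ∉ gs
    β∉gs β∈gs = disjoint (Any.map (λ β≡g → subst (_∈ ds) β≡g β∈ds) β∈gs)

-- punchIn and insertAt for a bound n that is not syntactically a successor.
punchIn′ : ∀ {n} → Fin n → Fin (ℕ.pred n) → Fin n
punchIn′ {suc n} = punchIn

insertAt′ : ∀ {A : Set} {n} → (Fin (ℕ.pred n) → A) → Fin n → A → Fin n → A
insertAt′ {n = suc n} = insertAt

punchIn′-injective : ∀ {n} (w : Fin n) {i j} → punchIn′ w i ≡ punchIn′ w j → i ≡ j
punchIn′-injective {suc n} w = Fin.punchIn-injective w _ _

punchIn′-view : ∀ {n} (w z : Fin n) → z ≡ w ⊎ ∃[ i ] (z ≡ punchIn′ w i)
punchIn′-view {suc n} w z with w Fin.≟ z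
... | yes w≡z = inj₁ (sym w≡z)
... | no w≢z  = inj₂ (punchOut w≢z , sym (Fin.punchIn-punchOut w≢z))

module _ {A : Set} where

  insertAt′-at : ∀ {n} (f : Fin (ℕ.pred n) → A) (w : Fin n) (a : A) → insertAt′ f w a w ≡ a
  insertAt′-at {suc n} = insertAt-lookup

  insertAt′-punchIn′ : ∀ {n} (f : Fin (ℕ.pred n) → A) (w : Fin n) (a : A) i →
                       insertAt′ f w a (punchIn′ w i) ≡ f i
  insertAt′-punchIn′ {suc n} = insertAt-punchIn

module _ {n} (w : Fin n) (R : Fin (ℕ.pred n) → Fin (ℕ.pred n) → Bool) where

  insertAtRel : Fin n → Fin n → Bool
  insertAtRel = insertAt′ (λ i → insertAt′ (R i) w false) w (λ _ → false)

  insertAtRel-at : ∀ z → insertAtRel w z ≡ false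
  insertAtRel-at = cong-app (insertAt′-at _ w _)

  insertAtRel-row : ∀ i → insertAtRel (punchIn′ w i) ≡ insertAt′ (R i) w false
  insertAtRel-row = insertAt′-punchIn′ _ w _

  insertAtRel-punchIn′ : ∀ i j → insertAtRel (punchIn′ w i) (punchIn′ w j) ≡ R i j
  insertAtRel-punchIn′ i j = trans (cong-app (insertAtRel-row i) _) (insertAt′-punchIn′ (R i) w false j)

  insertAtRel-atʳ : ∀ i → insertAtRel (punchIn′ w i) w ≡ false
  insertAtRel-atʳ i = trans (cong-app (insertAtRel-row i) w) (insertAt′-at (R i) w false)

  insertAtRel-sym : (∀ i j → R i j ≡ R j i) → ∀ z z′ → insertAtRel z z′ ≡ insertAtRel z′ z
  insertAtRel-sym R-sym z z′ with punchIn′-view w z | punchIn′-view w z′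
  ... | inj₁ refl       | inj₁ refl       = refl
  ... | inj₁ refl       | inj₂ (j , refl) = trans (insertAtRel-at _) (sym (insertAtRel-atʳ j))
  ... | inj₂ (i , refl) | inj₁ refl       = trans (insertAtRel-atʳ i) (sym (insertAtRel-at _))
  ... | inj₂ (i , refl) | inj₂ (j , refl) =
    trans (insertAtRel-punchIn′ i j) (trans (R-sym i j) (sym (insertAtRel-punchIn′ j i)))

  insertAtRel-true : ∀ z z′ → insertAtRel z z′ ≡ true →
                     ∃[ i ] ∃[ j ] (z ≡ punchIn′ w i × z′ ≡ punchIn′ w j × R i j ≡ true)
  insertAtRel-true z z′ Rzz′ with punchIn′-view w z | punchIn′-view w z′
  ... | inj₁ refl       | _               = contradiction (trans (sym (insertAtRel-at z′)) Rzz′) λ ()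
  ... | inj₂ (i , refl) | inj₁ refl       = contradiction (trans (sym (insertAtRel-atʳ i)) Rzz′) λ ()
  ... | inj₂ (i , refl) | inj₂ (j , refl) =
    i , j , refl , refl , trans (sym (insertAtRel-punchIn′ i j)) Rzz′

indicator : Bool → ℕ
indicator true  = 1
indicator false = 0

∣tabulate∣≡∑ : ∀ {n} (f : Fin n → Bool) → ∣ tabulate f ∣ ≡ ∑ (indicator ∘ f)
∣tabulate∣≡∑ {zero}  f = refl
∣tabulate∣≡∑ {suc n} f with f zero
... | true  = cong suc (∣tabulate∣≡∑ (f ∘ suc))
... | false = ∣tabulate∣≡∑ (f ∘ suc)

∑-punchIn′ : ∀ {n} (f : Fin n → ℕ) (w : Fin n) → ∑ f ≡ f w + ∑ (f ∘ punchIn′ w)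
∑-punchIn′ {suc n} f w = sum-remove f

sum-map-allFin : ∀ {n} (g : Fin n → ℕ) → sum (map g (allFin n)) ≡ ∑ g
sum-map-allFin g = trans (cong sum (map-tabulate id g)) (sum-tabulate g)
  where
  sum-tabulate : ∀ {n} (g : Fin n → ℕ) → sum (List.tabulate g) ≡ ∑ g
  sum-tabulate {zero}  g = refl
  sum-tabulate {suc n} g = cong (g zero +_) (sum-tabulate (g ∘ suc))

∣tabulate∣-punchIn′ : ∀ {n} (f : Fin n → Bool) (w : Fin n) →
                      ∣ tabulate f ∣ ≡ indicator (f w) + ∣ tabulate (f ∘ punchIn′ w) ∣
∣tabulate∣-punchIn′ f w = begin
  ∣ tabulate f ∣                                      ≡⟨ ∣tabulate∣≡∑ f ⟩
  ∑ (indicator ∘ f)                                   ≡⟨ ∑-punchIn′ (indicator ∘ f) w ⟩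
  indicator (f w) + ∑ (indicator ∘ f ∘ punchIn′ w)
    ≡⟨ cong (indicator (f w) +_) (∣tabulate∣≡∑ (f ∘ punchIn′ w)) ⟨
  indicator (f w) + ∣ tabulate (f ∘ punchIn′ w) ∣     ∎
  where open ≡-Reasoning

∣tabulate-insertAt′∣ : ∀ {n} (f : Fin (ℕ.pred n) → Bool) (w : Fin n) →
                       ∣ tabulate (insertAt′ f w false) ∣ ≡ ∣ tabulate f ∣
∣tabulate-insertAt′∣ f w = begin
  ∣ tabulate (insertAt′ f w false) ∣                            ≡⟨ ∣tabulate∣-punchIn′ _ w ⟩
  indicator (insertAt′ f w false w) + ∣ tabulate (insertAt′ f w false ∘ punchIn′ w) ∣
    ≡⟨ cong₂ (λ b g → indicator b + ∣ g ∣) (insertAt′-at f w false)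
             (Vec.tabulate-cong (insertAt′-punchIn′ f w false)) ⟩
  ∣ tabulate f ∣                                                ∎
  where open ≡-Reasoning

module _ (G : Graph) where
  open Graph G using (adj)

  Adj-sym : ∀ {a b} → Adj G a b → Adj G b a
  Adj-sym {a} {b} a∼b = trans (Graph.sym G b a) a∼b

  Adj-irrefl : ∀ {a} → ¬ Adj G a a
  Adj-irrefl {a} a∼a with trans (sym (Graph.irrefl G a)) a∼a
  ... | ()

  Adj⇒≢ : ∀ {a b} → Adj G a b → a ≢ b
  Adj⇒≢ a∼b refl = Adj-irrefl a∼b

  Dist≤2-sym : ∀ {a b} → Dist≤2 G a b → Dist≤2 G b a
  Dist≤2-sym (a≢b , inj₁ a∼b)             = ≢-sym a≢b , inj₁ (Adj-sym a∼b)
  Dist≤2-sym (a≢b , inj₂ (t , a∼t , t∼b)) = ≢-sym a≢b , inj₂ (t , Adj-sym t∼b , Adj-sym a∼t)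

  ≢-by-deg : ∀ {a b p q} → deg G a ≡ p → deg G b ≡ q → p ≢ q → a ≢ b
  ≢-by-deg da≡p db≡q p≢q refl = p≢q (trans (sym da≡p) db≡q)

  nbrs : V G → List (V G)
  nbrs u = List.filter (λ z → adj u z Bool.≟ true) (allFin _)

  ∈-nbrs⁺ : ∀ {u z} → Adj G u z → z ∈ nbrs u
  ∈-nbrs⁺ {u} {z} = ∈-filter⁺ (λ z → adj u z Bool.≟ true) (∈-allFin z)

  ∈-nbrs⁻ : ∀ {u z} → z ∈ nbrs u → Adj G u z
  ∈-nbrs⁻ {u} = proj₂ ∘ ∈-filter⁻ (λ z → adj u z Bool.≟ true) {xs = allFin _}

  length-nbrs : ∀ u → length (nbrs u) ≡ deg G u
  length-nbrs u = length-filter-tabulate id (adj u)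
    where
    length-filter-tabulate : ∀ {n} {A : Set} (g : Fin n → A) (f : A → Bool) →
      length (List.filter (λ a → f a Bool.≟ true) (List.tabulate g)) ≡ ∣ tabulate (f ∘ g) ∣
    length-filter-tabulate {zero}  g f = refl
    length-filter-tabulate {suc n} g f with f (g zero)
    ... | true  = cong suc (length-filter-tabulate (g ∘ suc) f)
    ... | false = length-filter-tabulate (g ∘ suc) f

  NbrsIn : V G → List (V G) → Set
  NbrsIn u xs = ∀ {z} → Adj G u z → z ∈ xs

  NbrsIn-exhausted : ∀ {u xs} → Unique xs → All (Adj G u) xs → deg G u ≤ length xs → NbrsIn u xs
  NbrsIn-exhausted {u} {xs} xs! u∼xs du≤xs {z} u∼z with DecMembership._∈?_ Fin._≟_ z xs
  ... | yes z∈xs = z∈xs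
  ... | no z∉xs  = contradiction (unique-⊆⇒length≤ (¬Any⇒All¬ xs z∉xs ∷ xs!) z∷xs⊆nbrs) too-long
    where
    z∷xs⊆nbrs : z ∷ xs ⊆ nbrs u
    z∷xs⊆nbrs (here refl) = ∈-nbrs⁺ u∼z
    z∷xs⊆nbrs (there p)   = ∈-nbrs⁺ (All.lookup u∼xs p)
    too-long : ¬ suc (length xs) ≤ length (nbrs u)
    too-long xs<nbrs = <⇒≱ xs<nbrs (≤-trans (≤-reflexive (length-nbrs u)) du≤xs)

  nbrs-except : V G → V G → List (V G)
  nbrs-except u t = List.filter (λ z → ¬? (z Fin.≟ t)) (nbrs u)

  ∈-nbrs-except⁻ : ∀ {u t z} → z ∈ nbrs-except u t → Adj G u z
  ∈-nbrs-except⁻ {u} {t} = ∈-nbrs⁻ ∘ proj₁ ∘ ∈-filter⁻ (λ z → ¬? (z Fin.≟ t)) {xs = nbrs u}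

  NbrsIn-except : ∀ u t → NbrsIn u (t ∷ nbrs-except u t)
  NbrsIn-except u t {z} u∼z with z Fin.≟ t
  ... | yes refl = here refl
  ... | no z≢t   = there (∈-filter⁺ (λ z → ¬? (z Fin.≟ t)) (∈-nbrs⁺ u∼z) z≢t)

  length-nbrs-except : ∀ {u t} → Adj G u t → length (nbrs-except u t) < deg G u
  length-nbrs-except {u} {t} u∼t = <-≤-trans
    (filter-notAll (λ z → ¬? (z Fin.≟ t)) (nbrs u) (Any.map (λ t≡z z≢t → z≢t (sym t≡z)) t∈nbrs))
    (≤-reflexive (length-nbrs u))
    where
    t∈nbrs : t ∈ nbrs u
    t∈nbrs = ∈-nbrs⁺ u∼t

  second-adj : ∀ {k u} (P : KPath G k u) → Adj G u (KPath.second P)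
  second-adj P = subst (λ s → Adj G s (KPath.second P)) (KPath.start P) (KPath.adjs P zero)

  second-deg : ∀ {u} (P : KPath G 1 u) → deg G (KPath.second P) ≡ 2
  second-deg P = KPath.internal P zero

  second∼other-end : ∀ {u} (P : KPath G 1 u) → Adj G (KPath.second P) (KPath.other-end P)
  second∼other-end P = KPath.adjs P (suc zero)

  other-end≢start : ∀ {u} (P : KPath G 1 u) → KPath.other-end P ≢ u
  other-end≢start P end≡u with KPath.inj P (suc (suc zero)) zero (trans end≡u (sym (KPath.start P)))
  ... | ()

  seconds : ∀ {ks u} → KVertex G ks u → List (V G)
  seconds kv = List.tabulate (KPath.second ∘ KVertex.paths kv)

  NbrsIn-seconds : ∀ {ks u} (kv : KVertex G ks u) → NbrsIn u (seconds kv)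
  NbrsIn-seconds kv = NbrsIn-exhausted
    (Unique.tabulate⁺ (KVertex.diff kv _ _))
    (All.tabulate⁺ (second-adj ∘ KVertex.paths kv))
    (≤-reflexive (trans (KVertex.degree kv) (sym (List.length-tabulate _))))

  KVertex111-nbrs-deg : ∀ {v z} → KVertex G (1 ∷ 1 ∷ 1 ∷ []) v → Adj G v z → deg G z ≡ 2
  KVertex111-nbrs-deg kv v∼z with NbrsIn-seconds kv v∼z
  ... | here refl                 = second-deg (KVertex.paths kv 0F)
  ... | there (here refl)         = second-deg (KVertex.paths kv 1F)
  ... | there (there (here refl)) = second-deg (KVertex.paths kv 2F)

module _ {A : Set} where

  lookup-∷ʳ-inject₁ : ∀ {n} (xs : Vec A n) x i → Vec.lookup (xs ∷ʳ x) (inject₁ i) ≡ Vec.lookup xs i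
  lookup-∷ʳ-inject₁ (_ ∷ _)  _ zero    = refl
  lookup-∷ʳ-inject₁ (_ ∷ xs) x (suc i) = lookup-∷ʳ-inject₁ xs x i

  lookup-∷ʳ-fromℕ : ∀ {n} (xs : Vec A n) x → Vec.lookup (xs ∷ʳ x) (fromℕ n) ≡ x
  lookup-∷ʳ-fromℕ []       _ = refl
  lookup-∷ʳ-fromℕ (_ ∷ xs) x = lookup-∷ʳ-fromℕ xs x

  Linked-lookup : ∀ {R : A → A → Set} {n} {xs : Vec A (suc n)} → Linked R xs →
                  ∀ i → R (Vec.lookup xs (inject₁ i)) (Vec.lookup xs (suc i))
  Linked-lookup {xs = _ ∷ _ ∷ _} (r ∷ _)  zero    = r
  Linked-lookup {xs = _ ∷ _ ∷ _} (_ ∷ rs) (suc i) = Linked-lookup rs i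

cycle : ∀ (G : Graph) {k} (vs : Vec (V G) (3 + k)) → UniqueVec vs →
        Linked (Adj G) (vs ∷ʳ Vec.head vs) → HasCycle G (3 + k)
cycle G vs@(v ∷ _) vs! linked =
  s≤s (s≤s (s≤s z≤n)) , Vec.lookup (vs ∷ʳ v) , sym (lookup-∷ʳ-fromℕ vs v) , injective ,
  Linked-lookup linked
  where
  injective : ∀ i j → Vec.lookup (vs ∷ʳ v) (inject₁ i) ≡ Vec.lookup (vs ∷ʳ v) (inject₁ j) → i ≡ j
  injective i j e = Vec.lookup-injective vs! i j
    (trans (sym (lookup-∷ʳ-inject₁ vs v i)) (trans e (lookup-∷ʳ-inject₁ vs v j)))

-- Deleting a vertex

_─_ : (G : Graph) → V G → Graph
G ─ w = record
  { n      = ℕ.pred n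
  ; adj    = λ i j → adj (punchIn′ w i) (punchIn′ w j)
  ; sym    = λ i j → Graph.sym G (punchIn′ w i) (punchIn′ w j)
  ; irrefl = λ i → irrefl (punchIn′ w i)
  }
  where open Graph G

-- A 2-distance colouring of G ─ w read in G: nothing is asked at w, nor across a path through w.
ColouringExcept : (G : Graph) → V G → (V G → List ℕ) → (V G → ℕ) → Set
ColouringExcept G w L c =
  (∀ {z} → z ≢ w → c z ∈ L z) ×
  (∀ {z z′} → z ≢ w → z′ ≢ w → Dist≤2 G z z′ → ¬ (Adj G z w × Adj G w z′) → c z ≢ c z′)

module _ (G : Graph) (w : V G) where
  open Graph G using (adj)

  deg-─ : ∀ i → deg G (punchIn′ w i) ≡ indicator (adj (punchIn′ w i) w) + deg (G ─ w) i
  deg-─ i = ∣tabulate∣-punchIn′ (adj (punchIn′ w i)) w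

  GirthGe-─ : ∀ {g} → GirthGe G g → GirthGe (G ─ w) g
  GirthGe-─ girth k k<g (3≤k , c , closed , c-inj , c-adj) =
    girth k k<g (3≤k , punchIn′ w ∘ c , cong (punchIn′ w) closed ,
                 (λ i j → c-inj i j ∘ punchIn′-injective w) , c-adj)

  MaxDegEq-─ : ∀ {d z} → MaxDegEq G d → deg G z ≡ d → z ≢ w → ¬ Adj G z w → MaxDegEq (G ─ w) d
  MaxDegEq-─ {d} {z} (deg≤d , _) dz≡d z≢w z≁w with punchIn′-view w z
  ... | inj₁ z≡w       = contradiction z≡w z≢w
  ... | inj₂ (i , refl) = deg─≤d , i , (begin
    deg (G ─ w) i                                   ≡⟨⟩
    indicator false + deg (G ─ w) i
      ≡⟨ cong (λ b → indicator b + deg (G ─ w) i) (¬-not z≁w) ⟨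
    indicator (adj z w) + deg (G ─ w) i             ≡⟨ deg-─ i ⟨
    deg G z                                         ≡⟨ dz≡d ⟩
    d                                               ∎)
    where
    open ≡-Reasoning
    deg─≤d : ∀ j → deg (G ─ w) j ≤ d
    deg─≤d j = ≤-trans (m≤n+m _ (indicator (adj (punchIn′ w j) w)))
                       (≤-trans (≤-reflexive (sym (deg-─ j))) (deg≤d (punchIn′ w j)))

  lift-subgraph : Subgraph (G ─ w) → Subgraph G
  lift-subgraph K = record
    { S      = tabulate (insertAt′ (Vec.lookup S) w false)
    ; F      = insertAtRel w F
    ; F-sym  = insertAtRel-sym w F F-sym
    ; F-sub  = F′-sub
    ; F-endˡ = F′-endˡ
    }
    where
    open Subgraph K
    F′-sub : ∀ z z′ → insertAtRel w F z z′ ≡ true → Adj G z z′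
    F′-sub z z′ Fzz′ with insertAtRel-true w F z z′ Fzz′
    ... | i , j , refl , refl , Fij = F-sub i j Fij
    S′ : Fin _ → Bool
    S′ = insertAt′ (Vec.lookup S) w false
    F′-endˡ : ∀ z z′ → insertAtRel w F z z′ ≡ true → z Subset.∈ tabulate S′
    F′-endˡ z z′ Fzz′ with insertAtRel-true w F z z′ Fzz′
    ... | i , j , refl , refl , Fij = Vec.lookup⇒[]= _ _ (begin
      Vec.lookup (tabulate S′) (punchIn′ w i) ≡⟨ Vec.lookup∘tabulate S′ (punchIn′ w i) ⟩
      S′ (punchIn′ w i)                       ≡⟨ insertAt′-punchIn′ _ w false i ⟩
      Vec.lookup S i                          ≡⟨ Vec.[]=⇒lookup (F-endˡ i j Fij) ⟩
      true                                    ∎)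
      where open ≡-Reasoning

  ∣S∣-lift : ∀ K → ∣ Subgraph.S (lift-subgraph K) ∣ ≡ ∣ Subgraph.S K ∣
  ∣S∣-lift K = trans (∣tabulate-insertAt′∣ (Vec.lookup S) w) (cong ∣_∣ (Vec.tabulate∘lookup S))
    where open Subgraph K

  degSum-lift : ∀ K → degSum G (lift-subgraph K) ≡ degSum (G ─ w) K
  degSum-lift K = begin
    degSum G (lift-subgraph K)                             ≡⟨ sum-map-allFin (rowSize) ⟩
    ∑ rowSize                                               ≡⟨ ∑-punchIn′ rowSize w ⟩
    rowSize w + ∑ (rowSize ∘ punchIn′ w)                   ≡⟨ cong₂ _+_ empty-row (sum-cong-≗ lifted-row) ⟩
    0 + ∑ (λ i → ∣ tabulate (F i) ∣)                       ≡⟨ sum-map-allFin (λ i → ∣ tabulate (F i) ∣) ⟨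
    degSum (G ─ w) K                                       ∎
    where
    open Subgraph K
    open ≡-Reasoning
    rowSize : V G → ℕ
    rowSize z = ∣ tabulate (insertAtRel w F z) ∣
    empty-row : rowSize w ≡ 0
    empty-row = begin
      rowSize w                                  ≡⟨ ∣tabulate∣≡∑ (insertAtRel w F w) ⟩
      ∑ (indicator ∘ insertAtRel w F w)         ≡⟨ sum-cong-≗ (cong indicator ∘ insertAtRel-at w F) ⟩
      ∑ {Graph.n G} (λ _ → 0)                   ≡⟨ sum-replicate-zero (Graph.n G) ⟩
      0                                         ∎
    lifted-row : ∀ i → rowSize (punchIn′ w i) ≡ ∣ tabulate (F i) ∣
    lifted-row i = trans (cong (∣_∣ ∘ tabulate) (insertAtRel-row w F i)) (∣tabulate-insertAt′∣ (F i) w)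

  MadLt5/2-─ : MadLt5/2 G → MadLt5/2 (G ─ w)
  MadLt5/2-─ mad K 0<∣S∣ =
    subst₂ (λ d s → 2 * d < 5 * s) (degSum-lift K) (∣S∣-lift K)
           (mad (lift-subgraph K) (subst (0 <_) (sym (∣S∣-lift K)) 0<∣S∣))

  Hyp-─ : ∀ {z} → Hyp G → deg G z ≡ 4 → z ≢ w → ¬ Adj G z w → Hyp (G ─ w)
  Hyp-─ (mad , girth , Δ) dz≡4 z≢w z≁w = MadLt5/2-─ mad , GirthGe-─ girth , MaxDegEq-─ Δ dz≡4 z≢w z≁w

  Choosable2-─ : ∀ {k} → Choosable2 (G ─ w) k → ∀ (L : V G → List ℕ) → (∀ z → Unique (L z)) →
                 (∀ z → k ≤ length (L z)) → ∃[ c ] ColouringExcept G w L c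
  Choosable2-─ choosable L L! k≤L
    with choosable (L ∘ punchIn′ w) (L! ∘ punchIn′ w) (k≤L ∘ punchIn′ w)
  ... | c , c∈L , c-proper = c₀ , c₀∈L , c₀-proper
    where
    c₀ : V G → ℕ
    c₀ = insertAt′ c w 0
    inner : ∀ {z} → z ≢ w → ∃[ i ] (z ≡ punchIn′ w i)
    inner {z} z≢w with punchIn′-view w z
    ... | inj₁ z≡w = contradiction z≡w z≢w
    ... | inj₂ i,z≡ι = i,z≡ι
    c₀∈L : ∀ {z} → z ≢ w → c₀ z ∈ L z
    c₀∈L z≢w with inner z≢w
    ... | i , refl = subst (_∈ L (punchIn′ w i)) (sym (insertAt′-punchIn′ c w 0 i)) (c∈L i)
    c₀-proper : ∀ {z z′} → z ≢ w → z′ ≢ w → Dist≤2 G z z′ → ¬ (Adj G z w × Adj G w z′) → c₀ z ≢ c₀ z′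
    c₀-proper z≢w z′≢w (z≢z′ , path) not-via-w with inner z≢w | inner z′≢w
    ... | i , refl | j , refl = λ c₀i≡c₀j → c-proper i j (z≢z′ ∘ cong (punchIn′ w) , path─ path)
      (trans (sym (insertAt′-punchIn′ c w 0 i)) (trans c₀i≡c₀j (insertAt′-punchIn′ c w 0 j)))
      where
      path─ : Adj G (punchIn′ w i) (punchIn′ w j) ⊎
              ∃[ t ] (Adj G (punchIn′ w i) t × Adj G t (punchIn′ w j)) →
              Adj (G ─ w) i j ⊎ ∃[ t ] (Adj (G ─ w) i t × Adj (G ─ w) t j)
      path─ (inj₁ i∼j) = inj₁ i∼j
      path─ (inj₂ (t , i∼t , t∼j)) with punchIn′-view w t
      ... | inj₁ refl       = contradiction (i∼t , t∼j) not-via-w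
      ... | inj₂ (k , refl) = inj₂ (k , i∼t , t∼j)

-- Recolouring finitely many vertices

module _ (G : Graph) {m} (s : Fin m → V G) where

  Outside : V G → Set
  Outside z = ∀ i → s i ≢ z

  patch-view : ∀ z → ∃[ i ] (s i ≡ z) ⊎ Outside z
  patch-view z with Fin.any? (λ i → s i Fin.≟ z)
  ... | yes hit = inj₁ hit
  ... | no miss = inj₂ (λ i sᵢ≡z → miss (i , sᵢ≡z))

  patch : (Fin m → ℕ) → (V G → ℕ) → V G → ℕ
  patch k c₀ z with patch-view z
  ... | inj₁ (i , _) = k i
  ... | inj₂ _       = c₀ z

  module _ (k : Fin m → ℕ) (c₀ : V G → ℕ) where

    patch-∈ : ∀ {L : V G → List ℕ} → (∀ i → k i ∈ L (s i)) → (∀ {z} → Outside z → c₀ z ∈ L z) →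
              ∀ z → patch k c₀ z ∈ L z
    patch-∈ k∈L c₀∈L z with patch-view z
    ... | inj₁ (i , refl) = k∈L i
    ... | inj₂ outside    = c₀∈L outside

    patch-proper : (∀ i j → Dist≤2 G (s i) (s j) → k i ≢ k j) →
                   (∀ i {z} → Outside z → Dist≤2 G (s i) z → k i ≢ c₀ z) →
                   (∀ {z z′} → Outside z → Outside z′ → Dist≤2 G z z′ → c₀ z ≢ c₀ z′) →
                   ∀ z z′ → Dist≤2 G z z′ → patch k c₀ z ≢ patch k c₀ z′
    patch-proper inside inside-outside outside z z′ d with patch-view z | patch-view z′
    ... | inj₁ (i , refl) | inj₁ (j , refl) = inside i j d
    ... | inj₁ (i , refl) | inj₂ out′       = inside-outside i out′ d
    ... | inj₂ out        | inj₁ (j , refl) = ≢-sym (inside-outside j out (Dist≤2-sym G d))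
    ... | inj₂ out        | inj₂ out′       = outside out out′ d

-- The special (1,1,0) configuration

record Special110Config (G : Graph) : Set where
  field
    u w₁ w₂ x v y : V G
    u-nbrs : NbrsIn G u (w₁ ∷ w₂ ∷ x ∷ [])
    u∼w₁   : Adj G u w₁
    u∼w₂   : Adj G u w₂
    u∼x    : Adj G u x
    w₁∼v   : Adj G w₁ v
    w₂∼y   : Adj G w₂ y
    deg-u  : deg G u ≡ 3
    deg-w₁ : deg G w₁ ≡ 2
    deg-w₂ : deg G w₂ ≡ 2
    deg-x  : deg G x ≡ 3
    deg-v  : deg G v ≡ 3
    deg-y  : deg G y ≡ 3
    v-nbrs-deg : ∀ {z} → Adj G v z → deg G z ≡ 2
    w₁≢w₂  : w₁ ≢ w₂
    y≢u    : y ≢ u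

module Special110Reducible {G : Graph} (cfg : Special110Config G) where
  open Special110Config cfg

  u≢w₁ : u ≢ w₁
  u≢w₁ = ≢-by-deg G deg-u deg-w₁ λ ()
  u≢w₂ : u ≢ w₂
  u≢w₂ = ≢-by-deg G deg-u deg-w₂ λ ()
  w₁≢v : w₁ ≢ v
  w₁≢v = ≢-by-deg G deg-w₁ deg-v λ ()
  w₂≢v : w₂ ≢ v
  w₂≢v = ≢-by-deg G deg-w₂ deg-v λ ()
  w₁≢y : w₁ ≢ y
  w₁≢y = ≢-by-deg G deg-w₁ deg-y λ ()

  u≢v : u ≢ v
  u≢v refl with trans (sym deg-x) (v-nbrs-deg u∼x)
  ... | ()

  w₁-nbrs : NbrsIn G w₁ (u ∷ v ∷ [])
  w₁-nbrs = NbrsIn-exhausted G ((u≢v ∷ []) ∷ [] ∷ []) (Adj-sym G u∼w₁ ∷ w₁∼v ∷ [])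
                              (≤-reflexive deg-w₁)

  w₂-nbrs : NbrsIn G w₂ (u ∷ y ∷ [])
  w₂-nbrs = NbrsIn-exhausted G ((≢-sym y≢u ∷ []) ∷ [] ∷ []) (Adj-sym G u∼w₂ ∷ w₂∼y ∷ [])
                              (≤-reflexive deg-w₂)

  X Y R : List (V G)
  X = nbrs-except G x u
  Y = nbrs-except G y w₂
  R = nbrs-except G v w₁

  length-X : length X ≤ 2
  length-X = ≤-pred (subst (length X <_) deg-x (length-nbrs-except G (Adj-sym G u∼x)))
  length-Y : length Y ≤ 2
  length-Y = ≤-pred (subst (length Y <_) deg-y (length-nbrs-except G (Adj-sym G w₂∼y)))
  length-R : length R ≤ 2
  length-R = ≤-pred (subst (length R <_) deg-v (length-nbrs-except G (Adj-sym G w₁∼v)))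

  S : Fin 4 → V G
  S = Vec.lookup (u ∷ w₁ ∷ w₂ ∷ v ∷ [])

  Out : V G → Set
  Out = Outside G S

  near-u near-w₁ near-w₂ near-v : List (V G)
  near-u  = x ∷ y ∷ X
  near-w₁ = x ∷ R
  near-w₂ = y ∷ x ∷ Y
  near-v  = List.concatMap (λ r → r ∷ nbrs-except G r v) R

  cover-u : ∀ {z} → Out z → Dist≤2 G u z → z ∈ near-u
  cover-u out (_ , inj₁ u∼z) with u-nbrs u∼z
  ... | here refl                 = ⊥-elim (out 1F refl)
  ... | there (here refl)         = ⊥-elim (out 2F refl)
  ... | there (there (here refl)) = here refl
  cover-u out (_ , inj₂ (t , u∼t , t∼z)) with u-nbrs u∼t
  ... | here refl with w₁-nbrs t∼z
  ...   | here refl         = ⊥-elim (out 0F refl)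
  ...   | there (here refl) = ⊥-elim (out 3F refl)
  cover-u out (_ , inj₂ (t , u∼t , t∼z)) | there (here refl) with w₂-nbrs t∼z
  ...   | here refl         = ⊥-elim (out 0F refl)
  ...   | there (here refl) = there (here refl)
  cover-u out (_ , inj₂ (t , u∼t , t∼z)) | there (there (here refl)) with NbrsIn-except G x u t∼z
  ...   | here refl = ⊥-elim (out 0F refl)
  ...   | there z∈X = there (there z∈X)

  cover-w₁ : ∀ {z} → Out z → Dist≤2 G w₁ z → z ∈ near-w₁
  cover-w₁ out (_ , inj₁ w₁∼z) with w₁-nbrs w₁∼z
  ... | here refl         = ⊥-elim (out 0F refl)
  ... | there (here refl) = ⊥-elim (out 3F refl)
  cover-w₁ out (_ , inj₂ (t , w₁∼t , t∼z)) with w₁-nbrs w₁∼t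
  ... | here refl with u-nbrs t∼z
  ...   | here refl                 = ⊥-elim (out 1F refl)
  ...   | there (here refl)         = ⊥-elim (out 2F refl)
  ...   | there (there (here refl)) = here refl
  cover-w₁ out (_ , inj₂ (t , w₁∼t , t∼z)) | there (here refl) with NbrsIn-except G v w₁ t∼z
  ...   | here refl = ⊥-elim (out 1F refl)
  ...   | there z∈R = there z∈R

  cover-w₂ : ∀ {z} → Out z → Dist≤2 G w₂ z → z ∈ near-w₂
  cover-w₂ out (_ , inj₁ w₂∼z) with w₂-nbrs w₂∼z
  ... | here refl         = ⊥-elim (out 0F refl)
  ... | there (here refl) = here refl
  cover-w₂ out (_ , inj₂ (t , w₂∼t , t∼z)) with w₂-nbrs w₂∼t
  ... | here refl with u-nbrs t∼z
  ...   | here refl                 = ⊥-elim (out 1F refl)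
  ...   | there (here refl)         = ⊥-elim (out 2F refl)
  ...   | there (there (here refl)) = there (here refl)
  cover-w₂ out (_ , inj₂ (t , w₂∼t , t∼z)) | there (here refl) with NbrsIn-except G y w₂ t∼z
  ...   | here refl = ⊥-elim (out 2F refl)
  ...   | there z∈Y = there (there z∈Y)

  cover-v : ∀ {z} → Out z → Dist≤2 G v z → z ∈ near-v
  cover-v out (_ , inj₁ v∼z) with NbrsIn-except G v w₁ v∼z
  ... | here refl = ⊥-elim (out 1F refl)
  ... | there z∈R = ∈-concatMap-∈ _ z∈R (here refl)
  cover-v out (_ , inj₂ (t , v∼t , t∼z)) with NbrsIn-except G v w₁ v∼t
  ... | here refl with w₁-nbrs t∼z
  ...   | here refl         = ⊥-elim (out 0F refl)
  ...   | there (here refl) = ⊥-elim (out 3F refl)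
  cover-v out (_ , inj₂ (t , v∼t , t∼z)) | there t∈R with NbrsIn-except G t v t∼z
  ...   | here refl = ⊥-elim (out 3F refl)
  ...   | there z∈ = ∈-concatMap-∈ _ t∈R (there z∈)

  near : Fin 4 → List (V G)
  near = Vec.lookup (near-u ∷ near-w₁ ∷ near-w₂ ∷ near-v ∷ [])

  near-covers : ∀ i {z} → Out z → Dist≤2 G (S i) z → z ∈ near i
  near-covers 0F = cover-u
  near-covers 1F = cover-w₁
  near-covers 2F = cover-w₂
  near-covers 3F = cover-v

  length-near-v : length near-v ≤ 4
  length-near-v = ≤-trans (length-concatMap-≤ _ (All.tabulate r-bound)) (*-monoˡ-≤ 2 length-R)
    where
    r-bound : ∀ {r} → r ∈ R → length (r ∷ nbrs-except G r v) ≤ 2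
    r-bound {r} r∈R =
      subst (length (nbrs-except G r v) <_) (v-nbrs-deg v∼r) (length-nbrs-except G (Adj-sym G v∼r))
      where v∼r = ∈-nbrs-except⁻ G r∈R

  module _ (girth : GirthGe G 10) where

    w₂-v-far : ¬ Dist≤2 G w₂ v
    w₂-v-far (_ , inj₁ w₂∼v) = girth 4 (from-yes (4 ℕ.<? 10)) (cycle G (u ∷ w₁ ∷ v ∷ w₂ ∷ [])
      ((u≢w₁ ∷ u≢v ∷ u≢w₂ ∷ []) ∷ (w₁≢v ∷ w₁≢w₂ ∷ []) ∷ (≢-sym w₂≢v ∷ []) ∷ [] ∷ [])
      (u∼w₁ ∷ w₁∼v ∷ Adj-sym G w₂∼v ∷ Adj-sym G u∼w₂ ∷ [-]))
    w₂-v-far (_ , inj₂ (t , w₂∼t , t∼v)) with w₂-nbrs w₂∼t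
    ... | here refl = girth 3 (from-yes (3 ℕ.<? 10)) (cycle G (u ∷ w₁ ∷ v ∷ [])
      ((u≢w₁ ∷ u≢v ∷ []) ∷ (w₁≢v ∷ []) ∷ [] ∷ [])
      (u∼w₁ ∷ w₁∼v ∷ Adj-sym G t∼v ∷ [-]))
    ... | there (here refl) = girth 5 (from-yes (5 ℕ.<? 10)) (cycle G (u ∷ w₁ ∷ v ∷ y ∷ w₂ ∷ [])
      ((u≢w₁ ∷ u≢v ∷ ≢-sym y≢u ∷ u≢w₂ ∷ []) ∷ (w₁≢v ∷ w₁≢y ∷ w₁≢w₂ ∷ []) ∷
       (≢-sym (Adj⇒≢ G t∼v) ∷ ≢-sym w₂≢v ∷ []) ∷ (≢-sym (Adj⇒≢ G w₂∼y) ∷ []) ∷ [] ∷ [])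
      (u∼w₁ ∷ w₁∼v ∷ Adj-sym G t∼v ∷ Adj-sym G w₂∼y ∷ Adj-sym G u∼w₂ ∷ [-]))

  module Extend (girth : GirthGe G 10) (L : V G → List ℕ) (L! : ∀ z → Unique (L z))
                (6≤L : ∀ z → 6 ≤ length (L z)) {c₀ : V G → ℕ} (c₀-ok : ColouringExcept G w₁ L c₀) where

    Free : Fin 4 → ℕ → Set
    Free i = L (S i) ∖ map c₀ (near i)

    free-avoidable : ∀ i {k} → length (near i) + suc k ≤ 6 → Avoidable k (Free i)
    free-avoidable i {k} bound = avoidable-∖ (L! (S i)) (≤-trans bound′ (6≤L (S i)))
      where bound′ = subst (λ l → l + suc k ≤ 6) (sym (List.length-map c₀ (near i))) bound

    open DiamondColouring (diamond-choosable
      (free-avoidable 0F (+-monoˡ-≤ 2 (s≤s (s≤s length-X))))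
      (free-avoidable 1F (+-monoˡ-≤ 3 (s≤s length-R)))
      (free-avoidable 2F (+-monoˡ-≤ 2 (s≤s (s≤s length-Y))))
      (free-avoidable 3F (+-monoˡ-≤ 2 length-near-v)))

    k : Fin 4 → ℕ
    k = Vec.lookup (h₁ ∷ h₂ ∷ t₁ ∷ t₂ ∷ [])

    k-free : ∀ i → Free i (k i)
    k-free 0F = h₁∈
    k-free 1F = h₂∈
    k-free 2F = t₁∈
    k-free 3F = t₂∈

    k-proper : ∀ i j → Dist≤2 G (S i) (S j) → k i ≢ k j
    k-proper 0F 0F (≢ , _) = contradiction refl ≢
    k-proper 0F 1F _ = h₁≢h₂
    k-proper 0F 2F _ = h₁≢t₁
    k-proper 0F 3F _ = h₁≢t₂
    k-proper 1F 0F _ = ≢-sym h₁≢h₂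
    k-proper 1F 1F (≢ , _) = contradiction refl ≢
    k-proper 1F 2F _ = h₂≢t₁
    k-proper 1F 3F _ = h₂≢t₂
    k-proper 2F 0F _ = ≢-sym h₁≢t₁
    k-proper 2F 1F _ = ≢-sym h₂≢t₁
    k-proper 2F 2F (≢ , _) = contradiction refl ≢
    k-proper 2F 3F d = contradiction d (w₂-v-far girth)
    k-proper 3F 0F _ = ≢-sym h₁≢t₂
    k-proper 3F 1F _ = ≢-sym h₂≢t₂
    k-proper 3F 2F d = contradiction (Dist≤2-sym G d) (w₂-v-far girth)
    k-proper 3F 3F (≢ , _) = contradiction refl ≢

    k-proper-near : ∀ i {z} → Out z → Dist≤2 G (S i) z → k i ≢ c₀ z
    k-proper-near i out d kᵢ≡c₀z =
      proj₂ (k-free i) (subst (_∈ map c₀ (near i)) (sym kᵢ≡c₀z) (∈-map⁺ c₀ (near-covers i out d)))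

    c₀-proper-outside : ∀ {z z′} → Out z → Out z′ → Dist≤2 G z z′ → c₀ z ≢ c₀ z′
    c₀-proper-outside {z} out out′ d = proj₂ c₀-ok (≢-sym (out 1F)) (≢-sym (out′ 1F)) d not-via-w₁
      where
      not-via-w₁ : ¬ (Adj G z w₁ × Adj G w₁ _)
      not-via-w₁ (z∼w₁ , _) with w₁-nbrs (Adj-sym G z∼w₁)
      ... | here refl         = out 0F refl
      ... | there (here refl) = out 3F refl

    colouring : Σ (V G → ℕ) λ c → (∀ z → c z ∈ L z) × (∀ z z′ → Dist≤2 G z z′ → c z ≢ c z′)
    colouring = patch G S k c₀
              , patch-∈ G S k c₀ (proj₁ ∘ k-free) (λ out → proj₁ c₀-ok (≢-sym (out 1F)))
              , patch-proper G S k c₀ k-proper k-proper-near c₀-proper-outside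

special110-reducible : ∀ {G} → MinimalCounterexample G → ¬ Special110Config G
special110-reducible {G} (hyp@(_ , girth , _ , z₄ , deg-z₄) , not-choosable , minimal) cfg =
  not-choosable choosable
  where
  open Special110Config cfg
  open Special110Reducible cfg
  z₄≁w₁ : ¬ Adj G z₄ w₁
  z₄≁w₁ z₄∼w₁ with w₁-nbrs (Adj-sym G z₄∼w₁)
  ... | here z₄≡u         = ≢-by-deg G deg-z₄ deg-u (λ ()) z₄≡u
  ... | there (here z₄≡v) = ≢-by-deg G deg-z₄ deg-v (λ ()) z₄≡v
  choosable : Choosable2 G 6
  choosable L L! 6≤L with Choosable2-─ G w₁ (minimal (G ─ w₁) smaller hyp─) L L! 6≤L
    where
    smaller = ≤-reflexive (suc-pred _ {{Fin.nonZeroIndex w₁}})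
    hyp─    = Hyp-─ G w₁ hyp deg-z₄ (≢-by-deg G deg-z₄ deg-w₁ λ ()) z₄≁w₁
  ... | _ , c₀-ok = Extend.colouring girth L L! 6≤L c₀-ok

special110-other-path : ∀ {G u w} → KVertex G (1 ∷ 1 ∷ 0 ∷ []) u → Adj G u w → deg G w ≡ 2 →
  Σ (KPath G 1 u) λ Q →
    ∃[ x ] (NbrsIn G u (w ∷ KPath.second Q ∷ x ∷ []) × w ≢ KPath.second Q × Adj G u x)
special110-other-path {G} kv u∼w deg-w with NbrsIn-seconds G kv u∼w
... | here refl =
  paths 1F , second (paths 2F) , NbrsIn-seconds G kv , (λ e → contradiction (diff 0F 1F e) λ ()) ,
  second-adj G (paths 2F)
  where open KVertex kv; open KPath
... | there (here refl) =
  paths 0F , second (paths 2F) , (λ u∼z → ∈-swap (NbrsIn-seconds G kv u∼z)) ,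
  (λ e → contradiction (diff 1F 0F e) λ ()) ,
  second-adj G (paths 2F)
  where open KVertex kv; open KPath
... | there (there (here refl)) =
  contradiction (subst (3 ≤_) deg-w (KPath.end3 (KVertex.paths kv 2F))) λ { (s≤s (s≤s ())) }

special110-dichotomy : ∀ {G u} → (∀ z → deg G z ≤ 4) → Special110 G u →
  ∃[ y ] (deg G y ≡ 4 × Common2Nbr G u y) ⊎ Special110Config G
special110-dichotomy {G} {u} Δ≤4 (kv , (x′ , u∼x′ , deg-x′) , v , (kv-v , _) , w , deg-w , u∼w , v∼w)
  with special110-other-path kv u∼w deg-w
... | Q , x , u-nbrs , w≢w₂ , u∼x with deg G (KPath.other-end Q) ℕ.≟ 4
...   | yes deg-y≡4 = inj₁ (KPath.other-end Q , deg-y≡4 , KPath.second Q , second-deg G Q , second-adj G Q ,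
                            Adj-sym G (second∼other-end G Q))
...   | no deg-y≢4 = inj₂ (record
  { u = u ; w₁ = w ; w₂ = KPath.second Q ; x = x ; v = v ; y = KPath.other-end Q
  ; u-nbrs = u-nbrs ; u∼w₁ = u∼w ; u∼w₂ = second-adj G Q ; u∼x = u∼x
  ; w₁∼v = Adj-sym G v∼w ; w₂∼y = second∼other-end G Q
  ; deg-u = KVertex.degree kv ; deg-w₁ = deg-w ; deg-w₂ = second-deg G Q ; deg-x = deg-x
  ; deg-v = KVertex.degree kv-v ; deg-y = deg-y ; v-nbrs-deg = KVertex111-nbrs-deg G kv-v
  ; w₁≢w₂ = w≢w₂ ; y≢u = other-end≢start G Q
  })
  where
  deg-x : deg G x ≡ 3
  deg-x with u-nbrs u∼x′
  ... | here refl                 = contradiction (trans (sym deg-x′) deg-w) λ ()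
  ... | there (here refl)         = contradiction (trans (sym deg-x′) (second-deg G Q)) λ ()
  ... | there (there (here refl)) = deg-x′
  deg-y : deg G (KPath.other-end Q) ≡ 3
  deg-y = ≤-antisym (≤-pred (≤∧≢⇒< (Δ≤4 _) deg-y≢4)) (KPath.end3 Q)

lemma18 : (G : Graph) → MinimalCounterexample G →
    ∀ (u : V G) → Special110 G u → ∃[ x ] (deg G x ≡ 4 × Common2Nbr G u x)
lemma18 G mc u special with special110-dichotomy (proj₁ (proj₂ (proj₂ (proj₁ mc)))) special
... | inj₁ partner = partner
... | inj₂ cfg     = ⊥-elim (special110-reducible mc cfg)
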